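{- Let $W$ be a layered wheel with rooted tree $T$, let $n\ge 8$ be an integer and let $G$ be an $n$-vertex induced subgraph of $W$. Then at least one of the following holds: (i) there is a node $u\in V(T)$ such that the number of descendants of $u$ lying in $V(G)$ is at least $\frac n{16}$ and at most $\frac n4$, and every node $v\in V(T)$ in the same layer as $u$ has at most $\frac n4$ descendants in $V(G)$; or (ii) there is a node $u\in V(T)$ and a child $u^+$ of $u$ such that the total number of descendants in $V(G)$ of all children of $u$ that are strictly to the right of the leftmost child of $u$ and strictly to the left of $u^+$ is at least $\frac n{16}$ and at most $\frac n8$.
   Context: A layered wheel is a countably infinite graph $W$ on the same vertex set as a countably infinite, locally finite, planarly embedded rooted tree $T$ such that: (1) for every natural number $n$, the set $L_n$ of nodes at distance $n$ from the root in $T$ (a layer) induces in $W$ a path going left-to-right in the planar embedding of $T$; these are the layer edges $E_L$; (2) every edge in $E(W)\setminus E_L$ joins a pair of nodes one of which is an ancestor of the other in $T$; (3) there is a bound on the length of paths in $T$ consisting only of vertices of degree 2 in $T$. Every node is its own descendant. Left/right among children of a node refers to the planar embedding of $T$. -}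

module Defs where

open import Data.Nat using (ℕ; zero; suc; _+_; _*_; _∸_; _<_; _≤_)
import Data.Nat as ℕ
open import Data.List using (List; []; _∷_; length; filter; applyUpTo)
open import Data.Nat.ListAction using (sum)
open import Data.Unit using (⊤)
open import Data.List.Relation.Unary.All using (All)
open import Data.List.Relation.Unary.Unique.Propositional using (Unique)
open import Data.List.Membership.Propositional using (_∈_; _∉_)
open import Data.List.Relation.Binary.Suffix.Heterogeneous using (Suffix)
open import Data.List.Relation.Binary.Suffix.Heterogeneous.Properties using (suffix?)
open import Data.Product using (Σ; ∃; ∃-syntax; _×_; _,_)
open import Data.Sum using (_⊎_)
open import Data.Empty using (⊥)
open import Relation.Nullary using (¬_)
open import Relation.Binary.PropositionalEquality using (_≡_)

-- A node is encoded by its address, written *leaf-first*: the root is [],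
-- and the i-th child (i = 0 leftmost, counting left to right in the
-- planar embedding) of the node a is  i ∷ a.
-- A tree is given by the number of children  nch a  of every node a
-- (finite: local finiteness).  The nodes of the tree are the valid
-- addresses.

Node : Set
Node = List ℕ

record PlaneTree : Set where
  field
    nch : Node → ℕ

module _ (T : PlaneTree) where
  open PlaneTree T

  data Valid : Node → Set where
    root  : Valid []
    child : ∀ {i a} → Valid a → i < nch a → Valid (i ∷ a)

  Infinite : Set
  Infinite = (xs : List Node) → ∃[ a ] (Valid a × a ∉ xs)

  TAdj : Node → Node → Set
  TAdj a b = (∃[ i ] (a ≡ i ∷ b)) ⊎ (∃[ i ] (b ≡ i ∷ a))

  degT : Node → ℕ
  degT []      = nch []
  degT (i ∷ a) = suc (nch (i ∷ a))

  Walk : List Node → Set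
  Walk []            = ⊤
  Walk (a ∷ [])      = ⊤
  Walk (a ∷ b ∷ ps)  = TAdj a b × Walk (b ∷ ps)

  IsPathT : List Node → Set
  IsPathT p = All Valid p × Unique p × Walk p

  BoundedDeg2Paths : Set
  BoundedDeg2Paths =
    ∃[ B ] ((p : List Node) → IsPathT p → All (λ v → degT v ≡ 2) p →
            length p ≤ B)

-- u is an ancestor of v (every node is its own ancestor / descendant)
Ancestor : Node → Node → Set
Ancestor u v = Suffix _≡_ u v

-- Left-to-right order of two nodes of the same layer in the planar
-- embedding (lexicographic order of root-first addresses).
data _◁_ : Node → Node → Set where
  here  : ∀ {i j a} → i < j → (i ∷ a) ◁ (j ∷ a)
  there : ∀ {i j a b} → a ◁ b → (i ∷ a) ◁ (j ∷ b)

record LayeredWheel (T : PlaneTree) : Set₁ where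
  field
    -- T is countably infinite (countability is automatic for addresses)
    infinite  : Infinite T
    E         : Node → Node → Set
    E-valid   : ∀ {a b} → E a b → Valid T a × Valid T b
    E-sym     : ∀ {a b} → E a b → E b a
    E-irrefl  : ∀ {a} → ¬ E a a
    -- (1) each layer induces the left-to-right path
    layer     : ∀ a b → Valid T a → Valid T b → length a ≡ length b →
                (E a b → (a ◁ b × ¬ (∃[ c ] (Valid T c × a ◁ c × c ◁ b)))
                       ⊎ (b ◁ a × ¬ (∃[ c ] (Valid T c × b ◁ c × c ◁ a))))
              × ((a ◁ b × ¬ (∃[ c ] (Valid T c × a ◁ c × c ◁ b))) → E a b)
    nonlayer  : ∀ a b → E a b → ¬ (length a ≡ length b) →
                Ancestor a b ⊎ Ancestor b a
    deg2      : BoundedDeg2Paths T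

descCount : List Node → Node → ℕ
descCount S u = length (filter (λ v → suffix? ℕ._≟_ u v) S)

-- total number of descendants in S of the children of u strictly to the
-- right of the leftmost child (index 0) and strictly left of child j
middleCount : List Node → Node → ℕ → ℕ
middleCount S u j = sum (applyUpTo (λ k → descCount S (suc k ∷ u)) (j ∸ 1))

{-# OPTIONS --safe #-}
module Submission where

-- Call a node heavy if more than n/4 of the vertices of G are its descendants.  The root is
-- heavy and nodes deeper than every vertex of G are not, so some layer contains a heavy node u
-- while the next layer contains none.  A child of u with at least n/16 descendants in G then
-- witnesses (i).  Otherwise every child of u has fewer than n/16; as u itself is counted at most
-- once, the children strictly between the leftmost and the rightmost one carry at least n/16
-- (here n ≥ 8 and integrality are needed), and the shortest run of them, starting from the
-- left, that reaches n/16 exceeds a run below n/16 by a single child, so it stays below n/8: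
-- this is (ii).

open import Defs
open import Data.Bool using (true; false)
open import Data.Nat
  using (ℕ; zero; suc; _+_; _*_; _∸_; _⊔_; _<_; _≤_; z≤n; s≤s; z<s; s<s; _≤?_; _<?_)
import Data.Nat as ℕ
open import Data.Nat.Properties
open import Data.Nat.ListAction using (sum)
open import Data.Nat.ListAction.Properties using (sum-++)
open import Data.Nat.Tactic.RingSolver using (solve-∀)
open import Data.List using (List; []; _∷_; [_]; _∷ʳ_; length; filter; applyUpTo)
open import Data.List.Properties
  using (applyUpTo-∷ʳ; filter-accept; filter-reject; filter-none; filter-all; ≡-dec)
open import Data.List.Relation.Unary.All using (All)
import Data.List.Relation.Unary.All as All
open import Data.List.Relation.Unary.All.Properties using (¬Any⇒All¬)
open import Data.List.Relation.Unary.Any using (any?)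
open import Data.List.Relation.Unary.AllPairs using ([]; _∷_)
open import Data.List.Relation.Unary.Unique.Propositional using (Unique)
open import Data.List.Relation.Binary.Pointwise using ([]; Pointwise-≡⇒≡; ≡⇒Pointwise-≡)
open import Data.List.Relation.Binary.Suffix.Heterogeneous using (here; there)
open import Data.List.Relation.Binary.Suffix.Heterogeneous.Properties using (suffix?; length-mono)
open import Data.Product using (∃-syntax; _×_; _,_)
open import Data.Sum using (_⊎_; inj₁; inj₂; [_,_]′)
open import Relation.Nullary using (¬_; Dec; yes; no; does; contradiction)
open import Relation.Nullary.Decidable using (_×-dec_; from-no)
open import Relation.Unary using (Pred; Decidable)
open import Relation.Binary.Definitions using (DecidableEquality)
open import Relation.Binary.PropositionalEquality
  using (_≡_; refl; sym; trans; cong; subst; ≢-sym)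
open ≤-Reasoning

sumBelow : ℕ → (ℕ → ℕ) → ℕ
sumBelow m f = sum (applyUpTo f m)

sumBelow-suc : ∀ m f → sumBelow (suc m) f ≡ sumBelow m f + f m
sumBelow-suc m f = begin-equality
  sum (applyUpTo f (suc m))   ≡⟨ cong sum (applyUpTo-∷ʳ f m) ⟨
  sum (applyUpTo f m ∷ʳ f m)  ≡⟨ sum-++ (applyUpTo f m) [ f m ] ⟩
  sumBelow m f + (f m + 0)    ≡⟨ cong (sumBelow m f +_) (+-identityʳ (f m)) ⟩
  sumBelow m f + f m          ∎

sumBelow-mono : ∀ m {f g : ℕ → ℕ} → (∀ i → i < m → f i ≤ g i) →
                sumBelow m f ≤ sumBelow m g
sumBelow-mono zero    f≤g = z≤n
sumBelow-mono (suc m) f≤g =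
  +-mono-≤ (f≤g 0 z<s) (sumBelow-mono m (λ i i<m → f≤g (suc i) (s<s i<m)))

sumBelow-mono-< : ∀ m {f g : ℕ → ℕ} → (∀ i → i < m → f i ≤ g i) →
                  ∀ {i} → i < m → f i < g i → sumBelow m f < sumBelow m g
sumBelow-mono-< (suc m) f≤g {zero}  _         f0<g0 =
  +-mono-<-≤ f0<g0 (sumBelow-mono m (λ i i<m → f≤g (suc i) (s<s i<m)))
sumBelow-mono-< (suc m) f≤g {suc i} (s<s i<m) fi<gi =
  +-mono-≤-< (f≤g 0 z<s) (sumBelow-mono-< m (λ j j<m → f≤g (suc j) (s<s j<m)) i<m fi<gi)

crossing : {P Q : ℕ → Set} → (∀ k → P k ⊎ Q k) → (∀ k → P k → ¬ Q k) →
           P 0 → ∀ t → Q t → ∃[ k ] (k < t × P k × Q (suc k))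
crossing P⊎Q P⇒¬Q P0 zero    Q0 = contradiction Q0 (P⇒¬Q 0 P0)
crossing P⊎Q P⇒¬Q P0 (suc t) Qt+1 with P⊎Q t
... | inj₁ Pt = t , ≤-refl , Pt , Qt+1
... | inj₂ Qt with crossing P⊎Q P⇒¬Q P0 t Qt
...   | k , k<t , Pk , Qk+1 = k , m<n⇒m<1+n k<t , Pk , Qk+1

2k*a<n∧2k*b<n⇒k*[a+b]<n : ∀ k a b {n} → 2 * k * a < n → 2 * k * b < n → k * (a + b) < n
2k*a<n∧2k*b<n⇒k*[a+b]<n k a b {n} 2ka<n 2kb<n = *-cancelˡ-≤ 2 (begin
  2 * suc (k * (a + b))              ≡⟨ identity k a b ⟩
  suc (2 * k * a) + suc (2 * k * b)  ≤⟨ +-mono-≤ 2ka<n 2kb<n ⟩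
  n + n                              ≡⟨ cong (n +_) (+-identityʳ n) ⟨
  2 * n                              ∎)
  where
  identity : ∀ k a b → 2 * suc (k * (a + b)) ≡ suc (2 * k * a) + suc (2 * k * b)
  identity = solve-∀

-- 4(n + 1) ≤ 16d ≤ 16 + 16x + 16q + 16y ≤ 16 + 16q + 2(n - 1) gives n + 3 ≤ 8 + 8q,
-- and n ≥ 8 rules out q = 0.
middle-lower-bound : ∀ {n d} x q y → 8 ≤ n → n < 4 * d → d ≤ suc (x + (q + y)) →
                     16 * x < n → 16 * y < n → n ≤ 16 * q
middle-lower-bound {n} {d} x q y 8≤n n<4d d≤ 16x<n 16y<n =
  n≤16q q (*-cancelˡ-≤ 2 (+-cancelʳ-≤ (n + n) _ _ doubled))
  where
  doubled : 2 * (n + 3) + (n + n) ≤ 2 * (8 + 8 * q) + (n + n)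
  doubled = begin
    2 * (n + 3) + (n + n)                            ≡⟨ lhs n ⟩
    4 * suc n + 2                                    ≤⟨ +-monoˡ-≤ 2 (*-monoʳ-≤ 4 n<4d) ⟩
    4 * (4 * d) + 2                                  ≡⟨ cong (_+ 2) (*-assoc 4 4 d) ⟨
    16 * d + 2                                       ≤⟨ +-monoˡ-≤ 2 (*-monoʳ-≤ 16 d≤) ⟩
    16 * suc (x + (q + y)) + 2                       ≡⟨ rhs x q y ⟩
    2 * (8 + 8 * q) + (suc (16 * x) + suc (16 * y))  ≤⟨ +-monoʳ-≤ _ (+-mono-≤ 16x<n 16y<n) ⟩
    2 * (8 + 8 * q) + (n + n)                        ∎
    where
    lhs : ∀ n → 2 * (n + 3) + (n + n) ≡ 4 * suc n + 2
    lhs = solve-∀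
    rhs : ∀ x q y →
          16 * suc (x + (q + y)) + 2 ≡ 2 * (8 + 8 * q) + (suc (16 * x) + suc (16 * y))
    rhs = solve-∀

  n≤16q : ∀ r → n + 3 ≤ 8 + 8 * r → n ≤ 16 * r
  n≤16q zero    n+3≤8    =
    contradiction (≤-trans (+-monoˡ-≤ 3 8≤n) n+3≤8) (from-no (11 ≤? 8))
  n≤16q (suc r) n+3≤8+8r = begin
    n                          ≤⟨ m≤m+n n 3 ⟩
    n + 3                      ≤⟨ n+3≤8+8r ⟩
    8 + 8 * suc r              ≤⟨ +-monoˡ-≤ (8 * suc r) (m≤m*n 8 (suc r)) ⟩
    8 * suc r + 8 * suc r      ≡⟨ *-distribʳ-+ (suc r) 8 8 ⟨
    16 * suc r                 ∎

middle-window : ∀ {n d} m (f : ℕ → ℕ) → 8 ≤ n → n < 4 * d → d ≤ suc (sumBelow m f) →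
                (∀ i → i < m → 16 * f i < n) →
                ∃[ j ] (j < m × n ≤ 16 * sumBelow (j ∸ 1) (λ k → f (suc k))
                              × 8 * sumBelow (j ∸ 1) (λ k → f (suc k)) ≤ n)
middle-window {n} zero f 8≤n n<4d d≤1 _ =
  contradiction (middle-lower-bound 0 0 0 8≤n n<4d d≤1 0<n 0<n) (<⇒≱ 0<n)
  where
  0<n : 0 < n
  0<n = <-≤-trans z<s 8≤n
middle-window {n} (suc zero) f 8≤n n<4d d≤ light =
  contradiction (middle-lower-bound (f 0) 0 0 8≤n n<4d d≤ (light 0 z<s) 0<n) (<⇒≱ 0<n)
  where
  0<n : 0 < n
  0<n = <-≤-trans z<s 8≤n
middle-window {n} {d} (suc (suc t)) f 8≤n n<4d d≤ light =
  window (crossing (λ s → <-≤-connex (16 * sumBelow s g) n) (λ _ → <⇒≱) 0<n t n≤16*middle)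
  where
  g : ℕ → ℕ
  g k = f (suc k)
  0<n : 0 < n
  0<n = <-≤-trans z<s 8≤n
  n≤16*middle : n ≤ 16 * sumBelow t g
  n≤16*middle = middle-lower-bound (f 0) (sumBelow t g) (g t) 8≤n n<4d
                  (subst (λ c → d ≤ suc (f 0 + c)) (sumBelow-suc t g) d≤)
                  (light 0 z<s) (light (suc t) ≤-refl)
  window : ∃[ s ] (s < t × 16 * sumBelow s g < n × n ≤ 16 * sumBelow (suc s) g) →
           ∃[ j ] (j < suc (suc t) × n ≤ 16 * sumBelow (j ∸ 1) g
                                   × 8 * sumBelow (j ∸ 1) g ≤ n)
  window (s , s<t , below , above) = suc (suc s) , s<s (s<s s<t) , above , <⇒≤ (begin-strict
    8 * sumBelow (suc s) g      ≡⟨ cong (8 *_) (sumBelow-suc s g) ⟩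
    8 * (sumBelow s g + g s)    <⟨ 2k*a<n∧2k*b<n⇒k*[a+b]<n 8 (sumBelow s g) (g s) below gs-light ⟩
    n                           ∎)
    where
    gs-light : 16 * g s < n
    gs-light = light (suc s) (s<s (m<n⇒m<1+n s<t))

module _ {a p} {A : Set a} {P : Pred A p} (P? : Decidable P) where

  length-filter-∷-≤ : ∀ x xs → length (filter P? xs) ≤ length (filter P? (x ∷ xs))
  length-filter-∷-≤ x xs with does (P? x)
  ... | true  = n≤1+n _
  ... | false = ≤-refl

  length-filter-accept : ∀ {x} xs → P x →
                         length (filter P? (x ∷ xs)) ≡ suc (length (filter P? xs))
  length-filter-accept xs px = cong length (filter-accept P? px)

  length-filter-reject : ∀ {x} xs → ¬ P x →
                         length (filter P? (x ∷ xs)) ≡ length (filter P? xs)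
  length-filter-reject xs ¬px = cong length (filter-reject P? ¬px)

ancestor-refl : ∀ u → Ancestor u u
ancestor-refl u = here (≡⇒Pointwise-≡ refl)

root-ancestor : ∀ u → Ancestor [] u
root-ancestor []      = here []
root-ancestor (_ ∷ u) = there (root-ancestor u)

ancestor-split : ∀ {u s} → Ancestor u s → u ≡ s ⊎ ∃[ i ] Ancestor (i ∷ u) s
ancestor-split (here u≋s) = inj₁ (Pointwise-≡⇒≡ u≋s)
ancestor-split (there {i} a) with ancestor-split a
... | inj₁ refl     = inj₂ (i , ancestor-refl (i ∷ _))
... | inj₂ (j , a′) = inj₂ (j , there a′)

any-ancestor? : {P : Node → Set} → Decidable P → ∀ s → Dec (∃[ v ] (Ancestor v s × P v))
any-ancestor? P? s with P? s
... | yes ps = yes (s , ancestor-refl s , ps)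
any-ancestor? P? []      | no ¬ps = no λ { (_ , here [] , pv) → ¬ps pv }
any-ancestor? {P} P? (i ∷ s) | no ¬ps with any-ancestor? P? s
... | yes (v , v≼s , pv) = yes (v , there v≼s , pv)
... | no ¬hit = no λ where
  (v , here v≋s , pv)  → ¬ps (subst P (Pointwise-≡⇒≡ v≋s) pv)
  (v , there v≼s , pv) → ¬hit (v , v≼s , pv)

ancestor? : ∀ u s → Dec (Ancestor u s)
ancestor? = suffix? ℕ._≟_

descCount-root : ∀ S → descCount S [] ≡ length S
descCount-root S = cong length (filter-all (ancestor? []) (All.universal root-ancestor S))

descCount-deep : ∀ {v} S → All (λ s → length s < length v) S → descCount S v ≡ 0
descCount-deep {v} S shallow =
  cong length (filter-none (ancestor? v)
    (All.map (λ s<v v≼s → <⇒≱ s<v (length-mono v≼s)) shallow))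

depth-bound : ∀ (S : List Node) → ∃[ D ] All (λ s → length s < D) S
depth-bound []      = 0 , All.[]
depth-bound (s ∷ S) with depth-bound S
... | D , shallow = suc (length s) ⊔ D ,
  m≤m⊔n (suc (length s)) D All.∷ All.map (λ s<D → ≤-trans s<D (m≤n⊔m _ D)) shallow

_≟ᴺ_ : DecidableEquality Node
_≟ᴺ_ = ≡-dec _≟_

multiplicity : Node → List Node → ℕ
multiplicity u R = length (filter (_≟ᴺ u) R)

multiplicity-unique : ∀ u {R} → Unique R → multiplicity u R ≤ 1
multiplicity-unique u {[]}    []           = z≤n
multiplicity-unique u {s ∷ R} (s∉R ∷ R!) with s ≟ᴺ u
... | yes refl = s≤s (≤-reflexive (cong length (filter-none _ (All.map ≢-sym s∉R))))
... | no _     = multiplicity-unique u R!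

module _ (T : PlaneTree) where
  open PlaneTree T

  valid-ancestor : ∀ {u s} → Ancestor u s → Valid T s → Valid T u
  valid-ancestor (here u≋s) vs = subst (Valid T) (sym (Pointwise-≡⇒≡ u≋s)) vs
  valid-ancestor (there a) (child vs _) = valid-ancestor a vs

  descendant-split : ∀ {u s} → Valid T s → Ancestor u s →
                     u ≡ s ⊎ ∃[ i ] (i < nch u × Ancestor (i ∷ u) s)
  descendant-split vs u≼s with ancestor-split u≼s
  ... | inj₁ u≡s = inj₁ u≡s
  ... | inj₂ (i , i∷u≼s) with valid-ancestor i∷u≼s vs
  ...   | child _ i<nch = inj₂ (i , i<nch , i∷u≼s)

  childrenCount : List Node → Node → ℕ
  childrenCount R u = sumBelow (nch u) (λ i → descCount R (i ∷ u))

  childrenCount-∷-≤ : ∀ s R u → childrenCount R u ≤ childrenCount (s ∷ R) u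
  childrenCount-∷-≤ s R u =
    sumBelow-mono (nch u) (λ i _ → length-filter-∷-≤ (ancestor? (i ∷ u)) s R)

  childrenCount-∷-< : ∀ {s i u} R → i < nch u → Ancestor (i ∷ u) s →
                      childrenCount R u < childrenCount (s ∷ R) u
  childrenCount-∷-< {s} {i} {u} R i<nch i∷u≼s =
    sumBelow-mono-< (nch u) (λ j _ → length-filter-∷-≤ (ancestor? (j ∷ u)) s R) i<nch
      (≤-reflexive (sym (length-filter-accept (ancestor? (i ∷ u)) R i∷u≼s)))

  descCount≤multiplicity+childrenCount : ∀ u {R} → All (Valid T) R →
                                         descCount R u ≤ multiplicity u R + childrenCount R u
  descCount≤multiplicity+childrenCount u {[]}    All.[]        = z≤n
  descCount≤multiplicity+childrenCount u {s ∷ R} (vs All.∷ vR)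
    with ih ← descCount≤multiplicity+childrenCount u vR | ancestor? u s
  ... | no u⋠s = begin
    descCount (s ∷ R) u                   ≡⟨ length-filter-reject (ancestor? u) R u⋠s ⟩
    descCount R u                         ≤⟨ ih ⟩
    multiplicity u R + childrenCount R u  ≤⟨ +-mono-≤ (length-filter-∷-≤ _ s R)
                                                      (childrenCount-∷-≤ s R u) ⟩
    multiplicity u (s ∷ R) + childrenCount (s ∷ R) u ∎
  ... | yes u≼s with descendant-split vs u≼s
  ...   | inj₁ refl = begin
    descCount (u ∷ R) u                         ≡⟨ length-filter-accept (ancestor? u) R u≼s ⟩
    suc (descCount R u)                         ≤⟨ s≤s ih ⟩
    suc (multiplicity u R) + childrenCount R u  ≡⟨ cong (_+ childrenCount R u)
                                                        (length-filter-accept (_≟ᴺ u) R refl) ⟨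
    multiplicity u (u ∷ R) + childrenCount R u  ≤⟨ +-monoʳ-≤ _ (childrenCount-∷-≤ u R u) ⟩
    multiplicity u (u ∷ R) + childrenCount (u ∷ R) u ∎
  ...   | inj₂ (i , i<nch , i∷u≼s) = begin
    descCount (s ∷ R) u                         ≡⟨ length-filter-accept (ancestor? u) R u≼s ⟩
    suc (descCount R u)                         ≤⟨ s≤s ih ⟩
    suc (multiplicity u R + childrenCount R u)  ≡⟨ +-suc (multiplicity u R) (childrenCount R u) ⟨
    multiplicity u R + suc (childrenCount R u)  ≤⟨ +-mono-≤ (length-filter-∷-≤ _ s R)
                                                            (childrenCount-∷-< R i<nch i∷u≼s) ⟩
    multiplicity u (s ∷ R) + childrenCount (s ∷ R) u ∎

  descCount≤1+childrenCount : ∀ u {R} → All (Valid T) R → Unique R →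
                              descCount R u ≤ suc (childrenCount R u)
  descCount≤1+childrenCount u valid unique = ≤-trans
    (descCount≤multiplicity+childrenCount u valid) (+-monoˡ-≤ _ (multiplicity-unique u unique))

  ancestor-witness⊎no-descendants :
    {P : Node → Set} → Decidable P → ∀ {S} → All (Valid T) S →
    (∃[ v ] (Valid T v × P v)) ⊎ (∀ {v} → P v → descCount S v ≡ 0)
  ancestor-witness⊎no-descendants P? {S} valid with any? (any-ancestor? P?) S
  ... | yes hit = let vs , v , v≼s , pv = All.lookupAny valid hit in
    inj₁ (v , valid-ancestor v≼s vs , pv)
  ... | no miss = inj₂ λ {v} pv → cong length (filter-none (ancestor? v)
    (All.map (λ ¬hit v≼s → ¬hit (v , v≼s , pv)) (¬Any⇒All¬ S miss)))

  module _ (S : List Node) (n : ℕ) where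

    HeavyLayer : ℕ → Set
    HeavyLayer k = ∃[ v ] (Valid T v × length v ≡ k × n < 4 * descCount S v)

    LightLayer : ℕ → Set
    LightLayer k = ∀ v → Valid T v → length v ≡ k → 4 * descCount S v ≤ n

    heavy⇒¬light : ∀ k → HeavyLayer k → ¬ LightLayer k
    heavy⇒¬light k (v , vv , |v|≡k , heavy) light = <⇒≱ heavy (light v vv |v|≡k)

    heavy⊎light : All (Valid T) S → ∀ k → HeavyLayer k ⊎ LightLayer k
    heavy⊎light valid k
      with ancestor-witness⊎no-descendants
             (λ v → (length v ℕ.≟ k) ×-dec (n <? 4 * descCount S v)) valid
    ... | inj₁ (v , vv , |v|≡k , heavy) = inj₁ (v , vv , |v|≡k , heavy)
    ... | inj₂ none = inj₂ λ v _ |v|≡k →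
      [ (λ heavy → subst (λ c → 4 * c ≤ n) (sym (none (|v|≡k , heavy))) z≤n)
      , (λ light → light)
      ]′ (<-≤-connex n (4 * descCount S v))

    root-heavy : length S ≡ n → 0 < n → HeavyLayer 0
    root-heavy |S|≡n 0<n = [] , root , refl ,
      subst (λ c → n < 4 * c) (sym (trans (descCount-root S) |S|≡n))
        (m<m+n n (≤-trans 0<n (m≤m+n n _)))

    deep-light : ∃[ D ] LightLayer D
    deep-light with depth-bound S
    ... | D , shallow =
      D , λ { v _ refl → subst (λ c → 4 * c ≤ n) (sym (descCount-deep S shallow)) z≤n }

    deepest-heavy-layer : All (Valid T) S → length S ≡ n → 0 < n →
                          ∃[ k ] (HeavyLayer k × LightLayer (suc k))
    deepest-heavy-layer valid |S|≡n 0<n with deep-light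
    ... | D , light-D
      with crossing (heavy⊎light valid) heavy⇒¬light (root-heavy |S|≡n 0<n) D light-D
    ...   | k , _ , heavy , light = k , heavy , light

lemma5p1 : (T : PlaneTree) (W : LayeredWheel T) (n : ℕ) → 8 ≤ n →
    (S : List Node) → All (Valid T) S → Unique S → length S ≡ n →
    (∃[ u ] (Valid T u × n ≤ 16 * descCount S u × 4 * descCount S u ≤ n
        × (∀ v → Valid T v → length v ≡ length u → 4 * descCount S v ≤ n)))
    ⊎
    (∃[ u ] ∃[ j ] (Valid T u × j < PlaneTree.nch T u
        × n ≤ 16 * middleCount S u j × 8 * middleCount S u j ≤ n))
lemma5p1 T _ n 8≤n S valid unique |S|≡n
  with deepest-heavy-layer T S n valid |S|≡n (<-≤-trans z<s 8≤n)
... | _ , (u , vu , refl , heavy) , light-below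
  with anyUpTo? (λ i → n ≤? 16 * descCount S (i ∷ u)) (PlaneTree.nch T u)
... | yes (i , i<nch , n≤16d) =
  let vi = child vu i<nch in inj₁ (i ∷ u , vi , n≤16d , light-below (i ∷ u) vi refl , light-below)
... | no no-heavy-child =
  let j , j<nch , window =
        middle-window (PlaneTree.nch T u) (λ i → descCount S (i ∷ u)) 8≤n heavy
          (descCount≤1+childrenCount T u valid unique)
          (λ i i<nch → ≰⇒> λ n≤16d → no-heavy-child (i , i<nch , n≤16d))
  in inj₂ (u , j , vu , j<nch , window)
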